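{- A connected graph $G$ is odd pan-free if and only if $G$ is bipartite, or complete multipartite, or a blowup of a cycle.
   Context: The odd pan graph $C_{2k+1}^*$ ($k\ge1$) is obtained from the cycle $C_{2k+1}$ by adding a new vertex adjacent to exactly one vertex of the cycle (so $C_3^*$, the paw, is included). A graph is odd pan-free if it has no induced subgraph isomorphic to $C_{2k+1}^*$ for any $k\ge 1$. Complete multipartite: vertex set partitioned into $V_1,\dots,V_r$ with $u,v$ adjacent iff they lie in different parts. Blowup of a cycle: vertex set partitioned into $V_1,\dots,V_r$ with $u,v$ adjacent iff $u\in V_i$, $v\in V_{i+1}$ for some $i$ (indices mod $r$). -}

module Defs where

open import Data.Nat using (ℕ; zero; suc; _+_; _*_; _<_; _≤_)
open import Data.Fin using (Fin; toℕ)
open import Data.Bool using (Bool; true; false)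
open import Data.Product using (Σ; ∃; ∃-syntax; _×_; _,_)
open import Data.Sum using (_⊎_)
open import Relation.Binary.PropositionalEquality using (_≡_; _≢_)
open import Relation.Nullary using (¬_)
open import Function.Bundles using (_⇔_)
open import Function.Definitions using (Injective)

record Graph (n : ℕ) : Set where
  field
    adj    : Fin n → Fin n → Bool
    sym    : ∀ u v → adj u v ≡ adj v u
    irrefl : ∀ u → adj u u ≡ false

open Graph public

E : ∀ {n} → Graph n → Fin n → Fin n → Set
E G u v = adj G u v ≡ true

data Walk {n : ℕ} (G : Graph n) : Fin n → Fin n → Set where
  here : ∀ {u} → Walk G u u
  step : ∀ {u v w} → E G u v → Walk G v w → Walk G u w

Connected : ∀ {n} → Graph n → Set
Connected {n} G = (u v : Fin n) → Walk G u v

CycAdj : ℕ → ℕ → ℕ → Set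
CycAdj m a b = (suc a ≡ b) ⊎ (suc b ≡ a) ⊎ (a ≡ 0 × suc b ≡ m) ⊎ (b ≡ 0 × suc a ≡ m)

-- Adjacency in the pan graph on Fin (suc m): vertices 0,…,m-1 form the
-- cycle C_m, vertex m is pendant, adjacent exactly to vertex 0.
PanAdj : (m : ℕ) → Fin (suc m) → Fin (suc m) → Set
PanAdj m i j =
  (toℕ i < m × toℕ j < m × CycAdj m (toℕ i) (toℕ j))
  ⊎ (toℕ i ≡ 0 × toℕ j ≡ m)
  ⊎ (toℕ i ≡ m × toℕ j ≡ 0)

HasInducedOddPan : ∀ {n} → Graph n → ℕ → Set
HasInducedOddPan {n} G k =
  let m = suc (2 * k) in
  Σ (Fin (suc m) → Fin n) λ f →
    Injective _≡_ _≡_ f × (∀ i j → PanAdj m i j ⇔ E G (f i) (f j))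

OddPanFree : ∀ {n} → Graph n → Set
OddPanFree G = ∀ k → 1 ≤ k → ¬ HasInducedOddPan G k

Bipartite : ∀ {n} → Graph n → Set
Bipartite {n} G = Σ (Fin n → Bool) λ c → ∀ (u v : Fin n) → E G u v → c u ≢ c v

CompleteMultipartite : ∀ {n} → Graph n → Set
CompleteMultipartite {n} G =
  Σ ℕ λ r → Σ (Fin n → Fin r) λ p →
    ∀ u v → E G u v ⇔ (p u ≢ p v)

BlowupOfCycle : ∀ {n} → Graph n → Set
BlowupOfCycle {n} G =
  Σ ℕ λ r → 3 ≤ r × (Σ (Fin n → Fin r) λ p →
    ∀ u v → E G u v ⇔ CycAdj r (toℕ (p u)) (toℕ (p v)))

{-# OPTIONS --safe #-}
module Submission where

-- If G is not bipartite, the parity of walks from a fixed vertex yields an odd closed walk,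
-- and a shortest odd closed walk is an induced odd cycle C: a repeated vertex or a chord
-- splits it into two shorter closed walks, one of which is odd.  Minimality is handled
-- constructively: each argument about C may instead produce a shorter odd closed walk,
-- and we recurse on its length.
--
-- If C is a triangle, excluding the paw (the odd pan with k = 1) and connectivity force
-- every vertex to be adjacent to an end of every edge, so non-adjacent vertices have the
-- same neighbours and G is complete multipartite.  If C has length at least five, a vertex
-- adjacent to C is adjacent to exactly the two cycle neighbours of one position, since any
-- other pattern closes a shorter odd cycle or an induced pan.  Replacing the cycle vertex at
-- that position by it gives another induced cycle, so by connectivity every vertex gets a
-- position, and these positions exhibit G as a blowup of C.
--
-- Conversely, an induced odd pan rules out each class: colours cannot alternate around its
-- odd cycle; two adjacent cycle vertices share the pendant vertex as a non-neighbour; and in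
-- a blowup of a cycle the three neighbours of the degree-3 vertex would fall into two parts,
-- although no two of them have the same neighbours.

open import Data.Nat
  using (ℕ; zero; suc; pred; _+_; _*_; _≤_; _<_; _≟_; _<?_; _≤?_; z≤n; s≤s; s≤s⁻¹; NonZero; >-nonZero; >-nonZero⁻¹)
open import Data.Nat.Properties
open import Data.Nat.DivMod using (_%_; %-distribˡ-+; [m+n]%n≡m%n; m<n⇒m%n≡m; m%n%n≡m%n; n%n≡0; m%n<n)
open import Data.Nat.Induction using (<-rec)
open import Data.Nat.Tactic.RingSolver using (solve-∀)
open import Data.Bool using (Bool; true; false; not; _xor_)
open import Data.Bool.Properties using (not-distribˡ-xor; not-distribʳ-xor; xor-same; xor-identityʳ; ¬-not)
open import Data.Fin as Fin using (Fin; toℕ; fromℕ<)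
open import Data.Fin.Properties using (toℕ-injective; toℕ<n; toℕ-fromℕ<)
open import Data.Product using (Σ; ∃; _×_; _,_; proj₁; proj₂)
open import Data.Sum using (_⊎_; inj₁; inj₂; [_,_]; swap; map; map₂)
open import Data.Empty using (⊥; ⊥-elim)
open import Function using (_∘_; case_of_)
open import Relation.Nullary using (¬_; Dec; yes; no; contradiction)
open import Relation.Nullary.Decidable using (_×-dec_; _⊎-dec_; ¬?; map′)
open import Relation.Binary.PropositionalEquality
  using (_≡_; _≢_; refl; sym; trans; cong; subst; subst₂; module ≡-Reasoning)
open import Function.Bundles using (_⇔_; mk⇔; Equivalence)
open import Function.Definitions using (Injective)
open import Defs hiding (sym)

module _ {m : ℕ} .{{_ : NonZero m}} where

  %-cong-+ˡ : ∀ a {x y} → x % m ≡ y % m → (a + x) % m ≡ (a + y) % m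
  %-cong-+ˡ a {x} {y} eq = begin
    (a + x) % m          ≡⟨ %-distribˡ-+ a x m ⟩
    (a % m + x % m) % m  ≡⟨ cong (λ t → (a % m + t) % m) eq ⟩
    (a % m + y % m) % m  ≡⟨ %-distribˡ-+ a y m ⟨
    (a + y) % m          ∎
    where open ≡-Reasoning

  %-cong-+ʳ : ∀ a {x y} → x % m ≡ y % m → (x + a) % m ≡ (y + a) % m
  %-cong-+ʳ a {x} {y} eq =
    trans (cong (_% m) (+-comm x a)) (trans (%-cong-+ˡ a eq) (cong (_% m) (+-comm a y)))

  %-cong-suc : ∀ {x y} → x % m ≡ y % m → suc x % m ≡ suc y % m
  %-cong-suc = %-cong-+ˡ 1

  %-cancel-suc : ∀ {x y} → suc x % m ≡ suc y % m → x % m ≡ y % m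
  %-cancel-suc {x} {y} eq = begin
    x % m                 ≡⟨ [m+n]%n≡m%n x m ⟨
    (x + m) % m           ≡⟨ cong (_% m) (wrap x) ⟩
    (pred m + suc x) % m  ≡⟨ %-cong-+ˡ (pred m) eq ⟩
    (pred m + suc y) % m  ≡⟨ cong (_% m) (wrap y) ⟨
    (y + m) % m           ≡⟨ [m+n]%n≡m%n y m ⟩
    y % m                 ∎
    where
    open ≡-Reasoning
    wrap : ∀ z → z + m ≡ pred m + suc z
    wrap z = begin
      z + m             ≡⟨ cong (z +_) (suc-pred m) ⟨
      z + suc (pred m)  ≡⟨ +-suc z (pred m) ⟩
      suc (z + pred m)  ≡⟨ cong suc (+-comm z (pred m)) ⟩
      suc (pred m + z)  ≡⟨ +-suc (pred m) z ⟨
      pred m + suc z    ∎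

  %-cancel-+ˡ : ∀ a {x y} → (a + x) % m ≡ (a + y) % m → x % m ≡ y % m
  %-cancel-+ˡ zero    eq = eq
  %-cancel-+ˡ (suc a) eq = %-cancel-+ˡ a (%-cancel-suc eq)

  %-injective-< : ∀ {x y} → x < m → y < m → x % m ≡ y % m → x ≡ y
  %-injective-< x<m y<m eq = trans (sym (m<n⇒m%n≡m x<m)) (trans eq (m<n⇒m%n≡m y<m))

  +-%-injectiveʳ : ∀ x {a b} → a < m → b < m → (x + a) % m ≡ (x + b) % m → a ≡ b
  +-%-injectiveʳ x a<m b<m = %-injective-< a<m b<m ∘ %-cancel-+ˡ x

  suc-+pred-% : ∀ b → suc (b + pred m) % m ≡ b % m
  suc-+pred-% b = trans (cong (_% m) (trans (sym (+-suc b (pred m))) (cong (b +_) (suc-pred m)))) ([m+n]%n≡m%n b m)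

  suc-%-cases : ∀ x → suc x % m ≡ suc (x % m) ⊎ (suc (x % m) ≡ m × suc x % m ≡ 0)
  suc-%-cases x with suc (x % m) <? m
  ... | yes lt = inj₁ (trans (%-cong-suc (sym (m%n%n≡m%n x m))) (m<n⇒m%n≡m lt))
  ... | no ¬lt = inj₂ (wraps , trans (%-cong-suc (sym (m%n%n≡m%n x m))) (trans (cong (_% m) wraps) (n%n≡0 m)))
    where
    wraps : suc (x % m) ≡ m
    wraps = ≤-antisym (m%n<n x m) (≮⇒≥ ¬lt)

  %-offset : ∀ a x → ∃ λ d → d < m × x % m ≡ (a + d) % m
  %-offset zero    x = x % m , m%n<n x m , sym (m%n%n≡m%n x m)
  %-offset (suc a) x with %-offset a x
  ... | suc d , d<m , eq = d , <-trans (n<1+n d) d<m , trans eq (cong (_% m) (+-suc a d))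
  ... | zero  , _   , eq = pred m , pred-< , (begin
    x % m                   ≡⟨ eq ⟩
    (a + 0) % m             ≡⟨ cong (_% m) (+-identityʳ a) ⟩
    a % m                   ≡⟨ [m+n]%n≡m%n a m ⟨
    (a + m) % m             ≡⟨ cong (λ t → (a + t) % m) (suc-pred m) ⟨
    (a + suc (pred m)) % m  ≡⟨ cong (_% m) (+-suc a (pred m)) ⟩
    (suc a + pred m) % m    ∎)
    where
    open ≡-Reasoning
    pred-< : pred m < m
    pred-< = ≤-reflexive (suc-pred m)

data CycAdjMod (m : ℕ) .{{_ : NonZero m}} (x y : ℕ) : Set where
  forward  : suc x % m ≡ y % m → CycAdjMod m x y
  backward : suc y % m ≡ x % m → CycAdjMod m x y

module _ {m : ℕ} .{{_ : NonZero m}} where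

  CycAdjMod-sym : ∀ {x y} → CycAdjMod m x y → CycAdjMod m y x
  CycAdjMod-sym (forward eq)  = backward eq
  CycAdjMod-sym (backward eq) = forward eq

  CycAdjMod-respˡ : ∀ {x x′ y} → x % m ≡ x′ % m → CycAdjMod m x y → CycAdjMod m x′ y
  CycAdjMod-respˡ eq (forward adj)  = forward (trans (%-cong-suc (sym eq)) adj)
  CycAdjMod-respˡ eq (backward adj) = backward (trans adj eq)

  CycAdjMod-respʳ : ∀ {x y y′} → y % m ≡ y′ % m → CycAdjMod m x y → CycAdjMod m x y′
  CycAdjMod-respʳ eq = CycAdjMod-sym ∘ CycAdjMod-respˡ eq ∘ CycAdjMod-sym

  CycAdjMod-irrefl : 2 ≤ m → ∀ x → ¬ CycAdjMod m x x
  CycAdjMod-irrefl 2≤m x (forward eq) = 1+n≢0 (%-injective-< 2≤m (≤-trans (s≤s z≤n) 2≤m)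
    (%-cancel-+ˡ x (trans (cong (_% m) (+-comm x 1)) (trans eq (cong (_% m) (sym (+-identityʳ x)))))))
  CycAdjMod-irrefl 2≤m x (backward eq) = CycAdjMod-irrefl 2≤m x (forward eq)

  CycAdjMod-cancel-+ˡ : ∀ a {x y} → CycAdjMod m (a + x) (a + y) → CycAdjMod m x y
  CycAdjMod-cancel-+ˡ a {x}     (forward eq)  = forward (%-cancel-+ˡ a (trans (cong (_% m) (+-suc a x)) eq))
  CycAdjMod-cancel-+ˡ a {y = y} (backward eq) = backward (%-cancel-+ˡ a (trans (cong (_% m) (+-suc a y)) eq))

  CycAdjMod-three : ∀ {s x y z} → CycAdjMod m s x → CycAdjMod m s y → CycAdjMod m s z →
                    x % m ≡ y % m ⊎ x % m ≡ z % m ⊎ y % m ≡ z % m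
  CycAdjMod-three (forward sx)  (forward sy)  _             = inj₁ (trans (sym sx) sy)
  CycAdjMod-three (backward xs) (backward ys) _             = inj₁ (%-cancel-suc (trans xs (sym ys)))
  CycAdjMod-three (forward sx)  (backward _)  (forward sz)  = inj₂ (inj₁ (trans (sym sx) sz))
  CycAdjMod-three (forward _)   (backward ys) (backward zs) = inj₂ (inj₂ (%-cancel-suc (trans ys (sym zs))))
  CycAdjMod-three (backward _)  (forward sy)  (forward sz)  = inj₂ (inj₂ (trans (sym sy) sz))
  CycAdjMod-three (backward xs) (forward _)   (backward zs) = inj₂ (inj₁ (%-cancel-suc (trans xs (sym zs))))

  CycAdjMod? : ∀ x y → Dec (CycAdjMod m x y)
  CycAdjMod? x y = map′ [ forward , backward ] (λ { (forward eq) → inj₁ eq ; (backward eq) → inj₂ eq })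
                        ((suc x % m ≟ y % m) ⊎-dec (suc y % m ≟ x % m))

  m%m≡0%m : m % m ≡ 0 % m
  m%m≡0%m = trans (n%n≡0 m) (sym (m<n⇒m%n≡m (>-nonZero⁻¹ m)))

  CycAdj⇒CycAdjMod : ∀ {x y} → CycAdj m x y → CycAdjMod m x y
  CycAdj⇒CycAdjMod (inj₁ eq)                        = forward (cong (_% m) eq)
  CycAdj⇒CycAdjMod (inj₂ (inj₁ eq))                 = backward (cong (_% m) eq)
  CycAdj⇒CycAdjMod (inj₂ (inj₂ (inj₁ (refl , eq)))) = backward (trans (cong (_% m) eq) m%m≡0%m)
  CycAdj⇒CycAdjMod (inj₂ (inj₂ (inj₂ (refl , eq)))) = forward (trans (cong (_% m) eq) m%m≡0%m)

  private
    suc-%⇒ : ∀ {x y} → x < m → y < m → suc x % m ≡ y % m → suc x ≡ y ⊎ (y ≡ 0 × suc x ≡ m)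
    suc-%⇒ x<m y<m eq with m≤n⇒m<n∨m≡n x<m
    ... | inj₁ sx<m  = inj₁ (%-injective-< sx<m y<m eq)
    ... | inj₂ sx≡m  = inj₂ (%-injective-< y<m (≤-trans (s≤s z≤n) x<m)
                              (trans (sym eq) (trans (cong (_% m) sx≡m) m%m≡0%m)) , sx≡m)

  CycAdjMod⇒CycAdj : ∀ {x y} → x < m → y < m → CycAdjMod m x y → CycAdj m x y
  CycAdjMod⇒CycAdj x<m y<m (forward eq) with suc-%⇒ x<m y<m eq
  ... | inj₁ adj = inj₁ adj
  ... | inj₂ adj = inj₂ (inj₂ (inj₂ adj))
  CycAdjMod⇒CycAdj x<m y<m (backward eq) with suc-%⇒ y<m x<m eq
  ... | inj₁ adj = inj₂ (inj₁ adj)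
  ... | inj₂ adj = inj₂ (inj₂ (inj₁ adj))

  CycAdjMod⇔CycAdj-% : ∀ x y → CycAdjMod m x y ⇔ CycAdj m (x % m) (y % m)
  CycAdjMod⇔CycAdj-% x y = mk⇔
    (CycAdjMod⇒CycAdj (m%n<n x m) (m%n<n y m) ∘
       CycAdjMod-respʳ (sym (m%n%n≡m%n y m)) ∘ CycAdjMod-respˡ (sym (m%n%n≡m%n x m)))
    (CycAdjMod-respʳ (m%n%n≡m%n y m) ∘ CycAdjMod-respˡ (m%n%n≡m%n x m) ∘ CycAdj⇒CycAdjMod)

  CycAdj-three : ∀ {a b₁ b₂ b₃} → b₁ < m → b₂ < m → b₃ < m →
                 CycAdj m a b₁ → CycAdj m a b₂ → CycAdj m a b₃ → b₁ ≡ b₂ ⊎ b₁ ≡ b₃ ⊎ b₂ ≡ b₃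
  CycAdj-three b₁<m b₂<m b₃<m adj₁ adj₂ adj₃ =
    map (%-injective-< b₁<m b₂<m) (map (%-injective-< b₁<m b₃<m) (%-injective-< b₂<m b₃<m))
      (CycAdjMod-three (CycAdj⇒CycAdjMod adj₁) (CycAdj⇒CycAdjMod adj₂) (CycAdj⇒CycAdjMod adj₃))

odd : ℕ → ℕ
odd k = suc (2 * k)

even⊎odd : ∀ a → (∃ λ q → a ≡ 2 * q) ⊎ (∃ λ q → a ≡ odd q)
even⊎odd zero = inj₁ (0 , refl)
even⊎odd (suc a) with even⊎odd a
... | inj₁ (q , refl) = inj₂ (q , refl)
... | inj₂ (q , refl) = inj₁ (suc q , cong suc (sym (+-suc q (q + 0))))

+≡odd⇒odd⊎odd : ∀ a b {s} → a + b ≡ odd s → (∃ λ q → a ≡ odd q) ⊎ (∃ λ q → b ≡ odd q)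
+≡odd⇒odd⊎odd a b {s} eq with even⊎odd a | even⊎odd b
... | inj₂ a-odd        | _               = inj₁ a-odd
... | inj₁ _            | inj₂ b-odd      = inj₂ b-odd
... | inj₁ (p , refl)   | inj₁ (q , refl) =
  contradiction (trans (*-distribˡ-+ 2 p q) eq) (even≢odd (p + q) s)

odd-suc : ∀ k → odd (suc k) ≡ 2 + odd k
odd-suc k = cong (suc ∘ suc) (+-suc k (k + 0))

odd-cancel-< : ∀ {p q} → odd p < odd q → p < q
odd-cancel-< {p} {q} lt = *-cancelˡ-< 2 p q (s≤s⁻¹ lt)

oddᵇ : ℕ → Bool
oddᵇ zero    = false
oddᵇ (suc n) = not (oddᵇ n)

oddᵇ-+ : ∀ a b → oddᵇ (a + b) ≡ oddᵇ a xor oddᵇ b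
oddᵇ-+ zero    b = refl
oddᵇ-+ (suc a) b = trans (cong not (oddᵇ-+ a b)) (not-distribˡ-xor (oddᵇ a) (oddᵇ b))

oddᵇ-2* : ∀ q → oddᵇ (2 * q) ≡ false
oddᵇ-2* q = begin
  oddᵇ (q + (q + 0))       ≡⟨ oddᵇ-+ q (q + 0) ⟩
  oddᵇ q xor oddᵇ (q + 0)  ≡⟨ cong (λ r → oddᵇ q xor oddᵇ r) (+-identityʳ q) ⟩
  oddᵇ q xor oddᵇ q        ≡⟨ xor-same (oddᵇ q) ⟩
  false                    ∎
  where open ≡-Reasoning

oddᵇ⇒odd : ∀ a → oddᵇ a ≡ true → ∃ λ k → a ≡ odd k
oddᵇ⇒odd a oddᵇa with even⊎odd a
... | inj₂ a-odd      = a-odd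
... | inj₁ (q , refl) = contradiction (trans (sym oddᵇa) (oddᵇ-2* q)) λ ()

sequence-⊎ : ∀ {N} {A : Set} {B : Fin N → Set} → (∀ v → A ⊎ B v) → A ⊎ (∀ v → B v)
sequence-⊎ {zero}  f = inj₂ λ ()
sequence-⊎ {suc N} f with f Fin.zero | sequence-⊎ (f ∘ Fin.suc)
... | inj₁ a  | _        = inj₁ a
... | inj₂ _  | inj₁ a   = inj₁ a
... | inj₂ b₀ | inj₂ bₛ  = inj₂ λ { Fin.zero → b₀ ; (Fin.suc v) → bₛ v }

-- The first position at which f is false; x must be such a position, and bounds the search.
firstFalse : ∀ {N} → (Fin N → Bool) → Fin N → Fin N
firstFalse {suc N} f x with f Fin.zero
... | false = Fin.zero
... | true with x
...   | Fin.zero  = Fin.zero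
...   | Fin.suc y = Fin.suc (firstFalse (f ∘ Fin.suc) y)

firstFalse-false : ∀ {N} (f : Fin N → Bool) x → f x ≡ false → f (firstFalse f x) ≡ false
firstFalse-false {suc N} f x fx≡false with f Fin.zero in f0
... | false = f0
... | true with x
...   | Fin.zero  = contradiction (trans (sym f0) fx≡false) λ ()
...   | Fin.suc y = firstFalse-false (f ∘ Fin.suc) y fx≡false

firstFalse-cong : ∀ {N} (f g : Fin N → Bool) x y → f x ≡ false → g y ≡ false → (∀ z → f z ≡ g z) →
                  firstFalse f x ≡ firstFalse g y
firstFalse-cong {suc N} f g x y fx≡false gy≡false f≗g with f Fin.zero in f0 | g Fin.zero in g0
... | false | false = refl
... | false | true  = contradiction (trans (sym f0) (trans (f≗g Fin.zero) g0)) λ ()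
... | true  | false = contradiction (trans (sym g0) (trans (sym (f≗g Fin.zero)) f0)) λ ()
... | true  | true with x | y
...   | Fin.zero  | _         = contradiction (trans (sym f0) fx≡false) λ ()
...   | Fin.suc _ | Fin.zero  = contradiction (trans (sym g0) gy≡false) λ ()
...   | Fin.suc x′ | Fin.suc y′ =
  cong Fin.suc (firstFalse-cong (f ∘ Fin.suc) (g ∘ Fin.suc) x′ y′ fx≡false gy≡false (f≗g ∘ Fin.suc))

module _ {n : ℕ} (G : Graph n) where

  E? : ∀ u v → Dec (E G u v)
  E? u v = adj G u v Data.Bool.≟ true

  E-sym : ∀ {u v} → E G u v → E G v u
  E-sym {u} {v} = trans (Graph.sym G v u)

  E-irrefl : ∀ {u} → ¬ E G u u
  E-irrefl {u} e = contradiction (trans (sym e) (irrefl G u)) λ ()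

  -- Closed walks and their reduction to induced odd cycles

  Path : ℕ → (ℕ → Fin n) → Set
  Path L u = ∀ t → t < L → E G (u t) (u (suc t))

  ClosedWalk : ℕ → (ℕ → Fin n) → Set
  ClosedWalk L u = Path L u × u L ≡ u 0

  ShorterOddClosedWalk : ℕ → Set
  ShorterOddClosedWalk k = ∃ λ k′ → k′ < k × Σ (ℕ → Fin n) (ClosedWalk (odd k′))

  no-loop : ∀ {u} → ¬ ClosedWalk 1 u
  no-loop {u} (p , closed) = E-irrefl (subst (E G (u 0)) closed (p 0 (s≤s z≤n)))

  Path-≤ : ∀ {d L u} → d ≤ L → Path L u → Path d u
  Path-≤ d≤L p t t<d = p t (<-≤-trans t<d d≤L)

  Path-drop : ∀ d {e u} → Path (d + e) u → Path e (λ t → u (d + t))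
  Path-drop d {u = u} p t t<e =
    subst (E G (u (d + t)) ∘ u) (sym (+-suc d t)) (p (d + t) (+-monoʳ-< d t<e))

  _◃_ : Fin n → (ℕ → Fin n) → ℕ → Fin n
  (v ◃ p) zero    = v
  (v ◃ p) (suc t) = p t

  ◃-path : ∀ {v p L} → E G v (p 0) → Path L p → Path (suc L) (v ◃ p)
  ◃-path e p zero    _   = e
  ◃-path e p (suc t) t<L = p t (s≤s⁻¹ t<L)

  -- Q 0, Q 1, …, Q c and then Q 0 again: a closed walk whenever Q c is adjacent to Q 0.
  shortcut : (ℕ → Fin n) → ℕ → ℕ → Fin n
  shortcut Q c t with t ≟ suc c
  ... | yes _ = Q 0
  ... | no  _ = Q t

  shortcut-end : ∀ Q c → shortcut Q c (suc c) ≡ Q 0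
  shortcut-end Q c with suc c ≟ suc c
  ... | yes _ = refl
  ... | no ≢c = contradiction refl ≢c

  shortcut-inner : ∀ Q c t → t ≢ suc c → shortcut Q c t ≡ Q t
  shortcut-inner Q c t t≢c with t ≟ suc c
  ... | yes t≡c = contradiction t≡c t≢c
  ... | no  _   = refl

  shortcut-closed : ∀ {Q c} → Path c Q → E G (Q 0) (Q c) → ClosedWalk (suc c) (shortcut Q c)
  shortcut-closed {Q} {c} p chord = edges , trans (shortcut-end Q c) (sym (shortcut-inner Q c 0 λ ()))
    where
    edges : Path (suc c) (shortcut Q c)
    edges t t<1+c with m≤n⇒m<n∨m≡n (s≤s⁻¹ t<1+c)
    ... | inj₁ t<c  = subst₂ (E G) (sym (shortcut-inner Q c t (<⇒≢ (m<n⇒m<1+n t<c))))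
                                   (sym (shortcut-inner Q c (suc t) (<⇒≢ (s≤s t<c)))) (p t t<c)
    ... | inj₂ refl = subst₂ (E G) (sym (shortcut-inner Q t t (<⇒≢ (n<1+n t))))
                                   (sym (shortcut-end Q t)) (E-sym chord)

  periodic-edge : ∀ {L u} .{{_ : NonZero L}} → ClosedWalk L u → ∀ t → E G (u (t % L)) (u (suc t % L))
  periodic-edge {L} {u} (p , closed) t with suc-%-cases {L} t
  ... | inj₁ eq           = subst (E G (u (t % L)) ∘ u) (sym eq) (p (t % L) (m%n<n t L))
  ... | inj₂ (wraps , eq) = subst (E G (u (t % L))) (trans (cong u wraps) (trans closed (cong u (sym eq))))
                              (p (t % L) (m%n<n t L))

  rotate-closed : ∀ {L u} .{{_ : NonZero L}} → ClosedWalk L u → ∀ i → ClosedWalk L (λ t → u ((i + t) % L))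
  rotate-closed {L} {u} cw i = edges , cong u (trans ([m+n]%n≡m%n i L) (cong (_% L) (sym (+-identityʳ i))))
    where
    edges : Path L (λ t → u ((i + t) % L))
    edges t _ = subst (λ s → E G (u ((i + t) % L)) (u (s % L))) (sym (+-suc i t)) (periodic-edge cw (i + t))

  split⇒shorter : ∀ {k a b s u v} → a + b ≡ odd s → a < odd k → b < odd k →
                  ClosedWalk a u → ClosedWalk b v → ShorterOddClosedWalk k
  split⇒shorter {a = a} {b} {s} eq a< b< cwu cwv with +≡odd⇒odd⊎odd a b {s} eq
  ... | inj₁ (q , refl) = q , odd-cancel-< a< , _ , cwu
  ... | inj₂ (q , refl) = q , odd-cancel-< b< , _ , cwv

  repeat⇒shorter : ∀ {k u d} → ClosedWalk (odd k) u → 0 < d → d < odd k → u d ≡ u 0 →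
                   ShorterOddClosedWalk k
  repeat⇒shorter {k} {u} {d} (p , closed) 0<d d<L ud≡u0 with m≤n⇒∃[o]m+o≡n (<⇒≤ d<L)
  ... | e , d+e≡L = split⇒shorter {s = k} d+e≡L d<L e<L (Path-≤ (<⇒≤ d<L) p , ud≡u0) (Path-drop d p′ , back)
    where
    p′ : Path (d + e) u
    p′ = subst (λ L → Path L u) (sym d+e≡L) p
    e<L : e < odd k
    e<L = subst (e <_) d+e≡L (m<n+m e 0<d)
    back : u (d + e) ≡ u (d + 0)
    back = trans (cong u d+e≡L) (trans closed (trans (sym ud≡u0) (cong u (sym (+-identityʳ d)))))

  chord⇒shorter : ∀ {k u d} → ClosedWalk (odd k) u → 2 ≤ d → 2 + d ≤ odd k → E G (u 0) (u d) →
                  ShorterOddClosedWalk k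
  chord⇒shorter {k} {u} {d} (p , closed) 2≤d 2+d≤L chord with m≤n⇒∃[o]m+o≡n (≤-trans (m≤n+m d 2) 2+d≤L)
  ... | e , d+e≡L = split⇒shorter {s = suc k} lengths 2+d≤L 1+e<L
                      (shortcut-closed (Path-≤ (m+n≤o⇒m≤o d (≤-reflexive d+e≡L)) p) chord)
                      (shortcut-closed (Path-drop d p′) chord′)
    where
    p′ : Path (d + e) u
    p′ = subst (λ L → Path L u) (sym d+e≡L) p
    chord′ : E G (u (d + 0)) (u (d + e))
    chord′ = subst₂ (λ x y → E G (u x) (u y)) (sym (+-identityʳ d)) (sym d+e≡L)
               (subst (E G (u d)) (sym closed) (E-sym chord))
    lengths : suc d + suc e ≡ odd (suc k)
    lengths = begin
      suc d + suc e            ≡⟨ cong suc (+-suc d e) ⟩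
      suc (suc (d + e))        ≡⟨ cong (suc ∘ suc) d+e≡L ⟩
      2 + odd k                ≡⟨ odd-suc k ⟨
      odd (suc k)              ∎
      where open ≡-Reasoning
    1+e<L : suc e < odd k
    1+e<L = subst (suc e <_) d+e≡L (+-monoˡ-≤ e 2≤d)

  record IsInducedCycle (m : ℕ) .{{_ : NonZero m}} (w : ℕ → Fin n) : Set where
    field
      vertex-cong      : ∀ x y → x % m ≡ y % m → w x ≡ w y
      vertex-injective : ∀ x y → w x ≡ w y → x % m ≡ y % m
      edge             : ∀ x → E G (w x) (w (suc x))
      edge⇒adjacent    : ∀ x y → E G (w x) (w y) → CycAdjMod m x y

  module Reduction {L u} .{{_ : NonZero L}} (cw : ClosedWalk L u) where

    P : ℕ → Fin n
    P t = u (t % L)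

    P-shift : ∀ x d → P (x % L + d) ≡ P (x + d)
    P-shift x d = cong u (%-cong-+ʳ d (m%n%n≡m%n x L))

    -- Offsets are measured from i + 0 so that the rotated walk λ t → P (i + t) starts there definitionally.
    RepeatAt : ℕ → Set
    RepeatAt i = ∃ λ d → d < L × (0 < d × P (i + d) ≡ P (i + 0))

    ChordAt : ℕ → Set
    ChordAt i = ∃ λ d → d < L × (2 ≤ d × (2 + d ≤ L × E G (P (i + 0)) (P (i + d))))

    RepeatAt? : ∀ i → Dec (RepeatAt i)
    RepeatAt? i = anyUpTo? (λ d → (0 <? d) ×-dec (P (i + d) Fin.≟ P (i + 0))) L

    ChordAt? : ∀ i → Dec (ChordAt i)
    ChordAt? i = anyUpTo? (λ d → (2 ≤? d) ×-dec ((2 + d ≤? L) ×-dec E? (P (i + 0)) (P (i + d)))) L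

    module _ (¬repeat : ∀ i → i < L → ¬ RepeatAt i) (¬chord : ∀ i → i < L → ¬ ChordAt i) where

      vertex-injective : ∀ x y → P x ≡ P y → x % L ≡ y % L
      vertex-injective x y Px≡Py with %-offset x y
      ... | zero  , _ , y≡x = sym (trans y≡x (cong (_% L) (+-identityʳ x)))
      ... | suc d , d<L , y≡x+d = contradiction (suc d , d<L , s≤s z≤n , repeat) (¬repeat (x % L) (m%n<n x L))
        where
        open ≡-Reasoning
        repeat : P (x % L + suc d) ≡ P (x % L + 0)
        repeat = begin
          P (x % L + suc d)  ≡⟨ P-shift x (suc d) ⟩
          P (x + suc d)      ≡⟨ cong u y≡x+d ⟨
          P y                ≡⟨ Px≡Py ⟨
          P x                ≡⟨ cong P (+-identityʳ x) ⟨
          P (x + 0)          ≡⟨ P-shift x 0 ⟨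
          P (x % L + 0)      ∎

      edge⇒adjacent : ∀ x y → E G (P x) (P y) → CycAdjMod L x y
      edge⇒adjacent x y e with %-offset x y
      ... | zero , _ , y≡x =
        contradiction (subst (E G (P x)) (cong u (trans y≡x (cong (_% L) (+-identityʳ x)))) e) E-irrefl
      ... | suc zero , _ , y≡x+1 = forward (trans (cong (_% L) (+-comm 1 x)) (sym y≡x+1))
      ... | suc (suc d) , d<L , y≡x+d with 2 + suc (suc d) ≤? L
      ...   | yes 2+d≤L =
        contradiction (suc (suc d) , d<L , s≤s (s≤s z≤n) , 2+d≤L , chord) (¬chord (x % L) (m%n<n x L))
        where
        chord : E G (P (x % L + 0)) (P (x % L + suc (suc d)))
        chord = subst₂ (E G) (trans (cong P (sym (+-identityʳ x))) (sym (P-shift x 0)))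
                             (trans (cong u y≡x+d) (sym (P-shift x (suc (suc d))))) e
      ...   | no  2+d≰L = backward (begin
        suc y % L                   ≡⟨ %-cong-suc y≡x+d ⟩
        suc (x + suc (suc d)) % L   ≡⟨ cong (_% L) (+-suc x (suc (suc d))) ⟨
        (x + suc (suc (suc d))) % L ≡⟨ cong (λ t → (x + t) % L) 1+d≡L ⟩
        (x + L) % L                 ≡⟨ [m+n]%n≡m%n x L ⟩
        x % L                       ∎)
        where
        open ≡-Reasoning
        1+d≡L : suc (suc (suc d)) ≡ L
        1+d≡L = ≤-antisym d<L (s≤s⁻¹ (≰⇒> 2+d≰L))

      isInducedCycle : IsInducedCycle L P
      isInducedCycle = record
        { vertex-cong      = λ x y → cong u
        ; vertex-injective = vertex-injective
        ; edge             = periodic-edge cw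
        ; edge⇒adjacent    = edge⇒adjacent
        }

  closedWalk⇒shorter⊎inducedCycle : ∀ {k u} (cw : ClosedWalk (odd k) u) →
    ShorterOddClosedWalk k ⊎ IsInducedCycle (odd k) (λ t → u (t % odd k))
  closedWalk⇒shorter⊎inducedCycle {k} cw
    with anyUpTo? (Reduction.RepeatAt? cw) (odd k) | anyUpTo? (Reduction.ChordAt? cw) (odd k)
  ... | yes (i , _ , d , d<L , 0<d , repeat) | _ =
    inj₁ (repeat⇒shorter (rotate-closed cw i) 0<d d<L repeat)
  ... | no _ | yes (i , _ , d , _ , 2≤d , 2+d≤L , chord) =
    inj₁ (chord⇒shorter (rotate-closed cw i) 2≤d 2+d≤L chord)
  ... | no ¬repeat | no ¬chord =
    inj₂ (Reduction.isInducedCycle cw (λ i i<L r → ¬repeat (i , i<L , r)) (λ i i<L c → ¬chord (i , i<L , c)))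

  module _ {R : Set} (handle : ∀ {k w} → IsInducedCycle (odd k) w → ShorterOddClosedWalk k ⊎ R) where

    oddClosedWalk-elim : ∀ k {u} → ClosedWalk (odd k) u → R
    oddClosedWalk-elim = <-rec (λ k → ∀ {u} → ClosedWalk (odd k) u → R) reduce
      where
      reduce : ∀ k → (∀ {k′} → k′ < k → ∀ {u} → ClosedWalk (odd k′) u → R) →
               ∀ {u} → ClosedWalk (odd k) u → R
      reduce k rec cw = [ recurse , [ recurse , (λ r → r) ] ∘ handle ] (closedWalk⇒shorter⊎inducedCycle cw)
        where
        recurse : ShorterOddClosedWalk k → R
        recurse (_ , k′<k , _ , cw′) = rec k′<k cw′

  record Clone (m : ℕ) .{{_ : NonZero m}} (w : ℕ → Fin n) (v : Fin n) (t : ℕ) : Set where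
    field
      neighbour⇒adjacent : ∀ x → E G v (w x) → CycAdjMod m t x
      adjacent⇒neighbour : ∀ x → CycAdjMod m t x → E G v (w x)

  module InducedCycle {m w} .{{_ : NonZero m}} (C : IsInducedCycle m w) where
    open IsInducedCycle C public

    adjacent⇒edge : ∀ x y → CycAdjMod m x y → E G (w x) (w y)
    adjacent⇒edge x y (forward eq) = subst (E G (w x)) (vertex-cong (suc x) y eq) (edge x)
    adjacent⇒edge x y (backward eq) = E-sym (subst (E G (w y)) (vertex-cong (suc y) x eq) (edge y))

    edge-back : ∀ b → E G (w (b + pred m)) (w b)
    edge-back b = subst (E G (w (b + pred m))) (vertex-cong _ b (suc-+pred-% b)) (edge (b + pred m))

    clone-self : ∀ x → Clone m w (w x) x
    clone-self x = record { neighbour⇒adjacent = edge⇒adjacent x ; adjacent⇒neighbour = adjacent⇒edge x }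

    clone-of-two : ∀ {v c} → E G v (w c) → E G v (w (c + 2)) →
                   (∀ x → E G v (w x) → x % m ≡ c % m ⊎ x % m ≡ (c + 2) % m) → Clone m w v (suc c)
    clone-of-two {v} {c} v~c v~c+2 only = record { neighbour⇒adjacent = to ; adjacent⇒neighbour = from }
      where
      to : ∀ x → E G v (w x) → CycAdjMod m (suc c) x
      to x e with only x e
      ... | inj₁ x≡c   = backward (%-cong-suc x≡c)
      ... | inj₂ x≡c+2 = forward (trans (cong (_% m) (+-comm 2 c)) (sym x≡c+2))
      from : ∀ x → CycAdjMod m (suc c) x → E G v (w x)
      from x (forward eq) = subst (E G v) (vertex-cong (c + 2) x (trans (cong (_% m) (+-comm c 2)) eq)) v~c+2
      from x (backward eq) = subst (E G v) (vertex-cong c x (sym (%-cancel-suc eq))) v~c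

    arc : ∀ a d → Path d (λ t → w (a + t))
    arc a d t _ = subst (E G (w (a + t)) ∘ w) (sym (+-suc a t)) (edge (a + t))

    detour : ∀ {v a d} → E G v (w a) → E G v (w (a + d)) →
             ClosedWalk (2 + d) (shortcut (v ◃ λ t → w (a + t)) (suc d))
    detour {v} {a} {d} v~a v~a+d =
      shortcut-closed (◃-path (subst (E G v ∘ w) (sym (+-identityʳ a)) v~a) (arc a d)) v~a+d

    rotate : ∀ a → IsInducedCycle m (λ x → w (a + x))
    rotate a = record
      { vertex-cong      = λ x y eq → vertex-cong (a + x) (a + y) (%-cong-+ˡ a eq)
      ; vertex-injective = λ x y eq → %-cancel-+ˡ a (vertex-injective (a + x) (a + y) eq)
      ; edge             = λ x → subst (E G (w (a + x)) ∘ w) (sym (+-suc a x)) (edge (a + x))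
      ; edge⇒adjacent    = λ x y e → CycAdjMod-cancel-+ˡ a (edge⇒adjacent (a + x) (a + y) e)
      }

  -- Induced pans and clones of cycle vertices

  InducedPan : ℕ → Set
  InducedPan m = Σ (Fin (suc m) → Fin n) λ f → Injective _≡_ _≡_ f × (∀ i j → PanAdj m i j ⇔ E G (f i) (f j))

  module _ {m w} .{{_ : NonZero m}} (3≤m : 3 ≤ m) (C : IsInducedCycle m w) where
    open InducedCycle C

    pendant-off-cycle : ∀ {z a} → (∀ x → E G z (w x) → x % m ≡ a % m) → ∀ b → z ≢ w b
    pendant-off-cycle {a = a} pendant b refl =
      <⇒≢ (pred-mono-≤ 3≤m) (+-%-injectiveʳ b 1<m (≤-reflexive (suc-pred m)) (begin
        (b + 1) % m       ≡⟨ cong (_% m) (+-comm b 1) ⟩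
        suc b % m         ≡⟨ pendant (suc b) (edge b) ⟩
        a % m             ≡⟨ pendant (b + pred m) (E-sym (edge-back b)) ⟨
        (b + pred m) % m  ∎))
      where
      open ≡-Reasoning
      1<m : 1 < m
      1<m = ≤-trans (s≤s (s≤s z≤n)) 3≤m

    module _ {z} (z~w₀ : E G z (w 0)) (pendant : ∀ x → E G z (w x) → x % m ≡ 0 % m) where

      panMap : Fin (suc m) → Fin n
      panMap i with toℕ i ≟ m
      ... | yes _ = z
      ... | no  _ = w (toℕ i)

      panMap-view : ∀ i → (toℕ i ≡ m × panMap i ≡ z) ⊎ (toℕ i < m × panMap i ≡ w (toℕ i))
      panMap-view i with toℕ i ≟ m
      ... | yes i≡m = inj₁ (i≡m , refl)
      ... | no  i≢m = inj₂ (≤∧≢⇒< (s≤s⁻¹ (toℕ<n i)) i≢m , refl)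

      panMap-pendant : ∀ {i} → toℕ i ≡ m → panMap i ≡ z
      panMap-pendant {i} i≡m with panMap-view i
      ... | inj₁ (_ , eq)   = eq
      ... | inj₂ (i<m , _) = contradiction i≡m (<⇒≢ i<m)

      panMap-cycle : ∀ {i} → toℕ i < m → panMap i ≡ w (toℕ i)
      panMap-cycle {i} i<m with panMap-view i
      ... | inj₁ (i≡m , _) = contradiction i≡m (<⇒≢ i<m)
      ... | inj₂ (_ , eq)  = eq

      panMap-0 : ∀ {i} → toℕ i ≡ 0 → panMap i ≡ w 0
      panMap-0 {i} i≡0 = trans (panMap-cycle (subst (_< m) (sym i≡0) (>-nonZero⁻¹ m))) (cong w i≡0)

      pendant-at-0 : ∀ {x} → x < m → E G z (w x) → x ≡ 0
      pendant-at-0 x<m e = %-injective-< x<m (>-nonZero⁻¹ m) (pendant _ e)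

      PanAdj⇒E : ∀ i j → PanAdj m i j → E G (panMap i) (panMap j)
      PanAdj⇒E i j (inj₁ (i<m , j<m , adj)) =
        subst₂ (E G) (sym (panMap-cycle i<m)) (sym (panMap-cycle j<m)) (adjacent⇒edge _ _ (CycAdj⇒CycAdjMod adj))
      PanAdj⇒E i j (inj₂ (inj₁ (i≡0 , j≡m))) =
        subst₂ (E G) (sym (panMap-0 i≡0)) (sym (panMap-pendant j≡m)) (E-sym z~w₀)
      PanAdj⇒E i j (inj₂ (inj₂ (i≡m , j≡0))) =
        subst₂ (E G) (sym (panMap-pendant i≡m)) (sym (panMap-0 j≡0)) z~w₀

      E⇒PanAdj : ∀ i j → E G (panMap i) (panMap j) → PanAdj m i j
      E⇒PanAdj i j e with panMap-view i | panMap-view j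
      ... | inj₁ (_ , fi≡z) | inj₁ (_ , fj≡z) = contradiction (subst₂ (E G) fi≡z fj≡z e) E-irrefl
      ... | inj₁ (i≡m , fi≡z) | inj₂ (j<m , fj≡w) =
        inj₂ (inj₂ (i≡m , pendant-at-0 j<m (subst₂ (E G) fi≡z fj≡w e)))
      ... | inj₂ (i<m , fi≡w) | inj₁ (j≡m , fj≡z) =
        inj₂ (inj₁ (pendant-at-0 i<m (E-sym (subst₂ (E G) fi≡w fj≡z e)) , j≡m))
      ... | inj₂ (i<m , fi≡w) | inj₂ (j<m , fj≡w) =
        inj₁ (i<m , j<m , CycAdjMod⇒CycAdj i<m j<m (edge⇒adjacent _ _ (subst₂ (E G) fi≡w fj≡w e)))

      panMap-injective : Injective _≡_ _≡_ panMap
      panMap-injective {i} {j} eq with panMap-view i | panMap-view j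
      ... | inj₁ (i≡m , _) | inj₁ (j≡m , _) = toℕ-injective (trans i≡m (sym j≡m))
      ... | inj₁ (_ , fi≡z) | inj₂ (_ , fj≡w) =
        contradiction (trans (sym fi≡z) (trans eq fj≡w)) (pendant-off-cycle pendant _)
      ... | inj₂ (_ , fi≡w) | inj₁ (_ , fj≡z) =
        contradiction (trans (sym fj≡z) (trans (sym eq) fi≡w)) (pendant-off-cycle pendant _)
      ... | inj₂ (i<m , fi≡w) | inj₂ (j<m , fj≡w) =
        toℕ-injective (%-injective-< i<m j<m (vertex-injective _ _ (trans (sym fi≡w) (trans eq fj≡w))))

      inducedPan₀ : InducedPan m
      inducedPan₀ = panMap , panMap-injective , λ i j → mk⇔ (PanAdj⇒E i j) (E⇒PanAdj i j)

  pendant⇒inducedPan : ∀ {m w z a} .{{_ : NonZero m}} → 3 ≤ m → IsInducedCycle m w →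
    E G z (w a) → (∀ x → E G z (w x) → x % m ≡ a % m) → InducedPan m
  pendant⇒inducedPan {m} {w} {z} {a} 3≤m C z~wₐ pendant =
    inducedPan₀ 3≤m (InducedCycle.rotate C a) (subst (E G z ∘ w) (sym (+-identityʳ a)) z~wₐ) pendant₀
    where
    pendant₀ : ∀ x → E G z (w (a + x)) → x % m ≡ 0 % m
    pendant₀ x e = %-cancel-+ˡ a (trans (pendant (a + x) e) (cong (_% m) (sym (+-identityʳ a))))

  module Replacement {m w} .{{_ : NonZero m}} (5≤m : 5 ≤ m) (C : IsInducedCycle m w) where
    open InducedCycle C

    clone-unique : ∀ {v i j} → Clone m w v i → Clone m w v j → i % m ≡ j % m
    clone-unique {v} {i} {j} ti tj
      with Clone.neighbour⇒adjacent tj (suc i) (Clone.adjacent⇒neighbour ti (suc i) (forward refl))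
         | Clone.neighbour⇒adjacent ti (suc j) (Clone.adjacent⇒neighbour tj (suc j) (forward refl))
    ... | forward j~i | _        = sym (%-cancel-suc j~i)
    ... | _        | forward i~j = %-cancel-suc i~j
    ... | backward i+2≡j | backward j+2≡i = contradiction
      (+-%-injectiveʳ i 5≤m (>-nonZero⁻¹ m) (begin
        (i + 4) % m              ≡⟨ cong (_% m) (+-comm i 4) ⟩
        suc (suc (2 + i)) % m    ≡⟨ %-cong-suc (%-cong-suc i+2≡j) ⟩
        suc (suc j) % m          ≡⟨ j+2≡i ⟩
        i % m                    ≡⟨ cong (_% m) (+-identityʳ i) ⟨
        (i + 0) % m              ∎)) λ ()
      where open ≡-Reasoning

    2≤m : 2 ≤ m
    2≤m = ≤-trans (s≤s (s≤s z≤n)) 5≤m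

    replace : ℕ → Fin n → ℕ → Fin n
    replace i u x with x % m ≟ i % m
    ... | yes _ = u
    ... | no  _ = w x

    replace-view : ∀ i u x → (x % m ≡ i % m × replace i u x ≡ u) ⊎ (x % m ≢ i % m × replace i u x ≡ w x)
    replace-view i u x with x % m ≟ i % m
    ... | yes eq = inj₁ (eq , refl)
    ... | no  ne = inj₂ (ne , refl)

    replace-here : ∀ i u → replace i u i ≡ u
    replace-here i u with replace-view i u i
    ... | inj₁ (_ , eq) = eq
    ... | inj₂ (i≢i , _) = contradiction refl i≢i

    replace-elsewhere : ∀ i u x → x % m ≢ i % m → replace i u x ≡ w x
    replace-elsewhere i u x x≢i with replace-view i u x
    ... | inj₁ (x≡i , _) = contradiction x≡i x≢i
    ... | inj₂ (_ , eq)  = eq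

    module _ {i u} (u-clone : Clone m w u i) where

      private
        W : ℕ → Fin n
        W = replace i u

      clone-on-cycle : ∀ y → w y ≡ u → i % m ≡ y % m
      clone-on-cycle y wy≡u = clone-unique u-clone (subst (λ v → Clone m w v y) wy≡u (clone-self y))

      replaced-vertex-cong : ∀ x y → x % m ≡ y % m → W x ≡ W y
      replaced-vertex-cong x y eq with replace-view i u x | replace-view i u y
      ... | inj₁ (_ , Wx≡u)   | inj₁ (_ , Wy≡u)   = trans Wx≡u (sym Wy≡u)
      ... | inj₁ (x≡i , _)    | inj₂ (y≢i , _)    = contradiction (trans (sym eq) x≡i) y≢i
      ... | inj₂ (x≢i , _)    | inj₁ (y≡i , _)    = contradiction (trans eq y≡i) x≢i
      ... | inj₂ (_ , Wx≡wx)  | inj₂ (_ , Wy≡wy)  = trans Wx≡wx (trans (vertex-cong x y eq) (sym Wy≡wy))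

      replaced-vertex-injective : ∀ x y → W x ≡ W y → x % m ≡ y % m
      replaced-vertex-injective x y eq with replace-view i u x | replace-view i u y
      ... | inj₁ (x≡i , _)    | inj₁ (y≡i , _)    = trans x≡i (sym y≡i)
      ... | inj₁ (x≡i , Wx≡u) | inj₂ (y≢i , Wy≡wy) =
        contradiction (sym (clone-on-cycle y (trans (sym Wy≡wy) (trans (sym eq) Wx≡u)))) y≢i
      ... | inj₂ (x≢i , Wx≡wx) | inj₁ (y≡i , Wy≡u) =
        contradiction (sym (clone-on-cycle x (trans (sym Wx≡wx) (trans eq Wy≡u)))) x≢i
      ... | inj₂ (_ , Wx≡wx)  | inj₂ (_ , Wy≡wy)  = vertex-injective x y (trans (sym Wx≡wx) (trans eq Wy≡wy))

      replaced-edge : ∀ x → E G (W x) (W (suc x))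
      replaced-edge x with replace-view i u x | replace-view i u (suc x)
      ... | inj₁ (x≡i , _)    | inj₁ (sx≡i , _)   =
        contradiction (trans x≡i (sym sx≡i)) (CycAdjMod-irrefl 2≤m x ∘ backward ∘ sym)
      ... | inj₁ (x≡i , Wx≡u) | inj₂ (_ , Wsx≡w)  =
        subst₂ (E G) (sym Wx≡u) (sym Wsx≡w)
          (Clone.adjacent⇒neighbour u-clone (suc x) (forward (%-cong-suc (sym x≡i))))
      ... | inj₂ (_ , Wx≡w)   | inj₁ (sx≡i , Wsx≡u) =
        subst₂ (E G) (sym Wx≡w) (sym Wsx≡u) (E-sym (Clone.adjacent⇒neighbour u-clone x (backward sx≡i)))
      ... | inj₂ (_ , Wx≡w)   | inj₂ (_ , Wsx≡w)  = subst₂ (E G) (sym Wx≡w) (sym Wsx≡w) (edge x)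

      replaced-edge⇒adjacent : ∀ x y → E G (W x) (W y) → CycAdjMod m x y
      replaced-edge⇒adjacent x y e with replace-view i u x | replace-view i u y
      ... | inj₁ (_ , Wx≡u)   | inj₁ (_ , Wy≡u)   = contradiction (subst₂ (E G) Wx≡u Wy≡u e) E-irrefl
      ... | inj₁ (x≡i , Wx≡u) | inj₂ (_ , Wy≡w)   =
        CycAdjMod-respˡ (sym x≡i) (Clone.neighbour⇒adjacent u-clone y (subst₂ (E G) Wx≡u Wy≡w e))
      ... | inj₂ (_ , Wx≡w)   | inj₁ (y≡i , Wy≡u) =
        CycAdjMod-sym (CycAdjMod-respˡ (sym y≡i)
          (Clone.neighbour⇒adjacent u-clone x (E-sym (subst₂ (E G) Wx≡w Wy≡u e))))
      ... | inj₂ (_ , Wx≡w)   | inj₂ (_ , Wy≡w)   = edge⇒adjacent x y (subst₂ (E G) Wx≡w Wy≡w e)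

      replace-isInducedCycle : IsInducedCycle m (replace i u)
      replace-isInducedCycle = record
        { vertex-cong      = replaced-vertex-cong
        ; vertex-injective = replaced-vertex-injective
        ; edge             = replaced-edge
        ; edge⇒adjacent    = replaced-edge⇒adjacent
        }

  module _ (pf : OddPanFree G) where

    pendant⇒⊥ : ∀ {k w z a} → 1 ≤ k → IsInducedCycle (odd k) w → E G z (w a) →
                (∀ x → E G z (w x) → x % odd k ≡ a % odd k) → ⊥
    pendant⇒⊥ {k} 1≤k C z~a pendant = pf k 1≤k (pendant⇒inducedPan (s≤s (*-monoʳ-≤ 2 1≤k)) C z~a pendant)

    module Classification {h w} (C : IsInducedCycle (odd (2 + h)) w) where
      open InducedCycle C

      private
        k m : ℕ
        k = 2 + h
        m = odd k

      odd-detour⇒shorter : ∀ {v a e} → E G v (w a) → E G v (w (a + odd e)) → suc e < k → ShorterOddClosedWalk k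
      odd-detour⇒shorter {v} {a} {e} v~a v~a+d sₑ<k = suc e , sₑ<k , _ ,
        subst (λ L → ClosedWalk L (shortcut (v ◃ λ t → w (a + t)) (suc (odd e)))) (sym (odd-suc e)) (detour v~a v~a+d)

      even-detour⇒shorter : ∀ {v a e f} → E G v (w a) → E G v (w (a + 2 * e)) → 2 ≤ e → e + f ≡ k →
                            ShorterOddClosedWalk k
      even-detour⇒shorter {v} {a} {e} {f} v~a v~a+d 2≤e e+f≡k =
        odd-detour⇒shorter v~a+d (subst (E G v) (vertex-cong a _ (sym around)) v~a)
          (subst (suc f <_) e+f≡k (+-monoˡ-≤ f 2≤e))
        where
        around : (a + 2 * e + odd f) % m ≡ a % m
        around = trans (cong (_% m) (trans (sum a e f) (cong (λ q → a + odd q) e+f≡k))) ([m+n]%n≡m%n a m)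
          where
          sum : ∀ a e f → a + 2 * e + suc (2 * f) ≡ a + suc (2 * (e + f))
          sum = solve-∀

      -- A neighbour of v at any other offset from a closes an odd cycle through v shorter than C.
      Expected : ℕ → Set
      Expected d = d ≡ 0 ⊎ d ≡ 2 ⊎ d ≡ odd (suc h)

      Unexpected : Fin n → ℕ → ℕ → Set
      Unexpected v a d = E G v (w (a + d)) × ¬ Expected d

      Unexpected? : ∀ v a d → Dec (Unexpected v a d)
      Unexpected? v a d = E? v (w (a + d)) ×-dec ¬? ((d ≟ 0) ⊎-dec ((d ≟ 2) ⊎-dec (d ≟ odd (suc h))))

      unexpected⇒shorter : ∀ {v a d} → E G v (w a) → d < m → Unexpected v a d → ShorterOddClosedWalk k
      unexpected⇒shorter {d = d} v~a d<m (v~a+d , unexpected) with even⊎odd d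
      ... | inj₁ (e , refl) = even-detour⇒shorter v~a v~a+d (2≤e e unexpected) (m+[n∸m]≡n e≤k)
        where
        2≤e : ∀ e → ¬ Expected (2 * e) → 2 ≤ e
        2≤e zero          unexp = contradiction (inj₁ refl) unexp
        2≤e (suc zero)    unexp = contradiction (inj₂ (inj₁ refl)) unexp
        2≤e (suc (suc _)) _     = s≤s (s≤s z≤n)
        e≤k : e ≤ k
        e≤k = *-cancelˡ-≤ 2 (s≤s⁻¹ d<m)
      ... | inj₂ (e , refl) = odd-detour⇒shorter {e = e} v~a v~a+d
        (s≤s (≤∧≢⇒< (s≤s⁻¹ (odd-cancel-< {e} {k} d<m))
                    λ e≡1+h → unexpected (inj₂ (inj₂ (cong odd e≡1+h)))))

      only-expected : ∀ {v a} → (∀ d → d < m → ¬ Unexpected v a d) → ∀ x → E G v (w x) →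
                      x % m ≡ a % m ⊎ x % m ≡ (a + 2) % m ⊎ x % m ≡ (a + odd (suc h)) % m
      only-expected {v} {a} none x v~x with %-offset {m} a x
      ... | d , d<m , x≡a+d with (d ≟ 0) ⊎-dec ((d ≟ 2) ⊎-dec (d ≟ odd (suc h)))
      ...   | yes (inj₁ refl)        = inj₁ (trans x≡a+d (cong (_% m) (+-identityʳ a)))
      ...   | yes (inj₂ (inj₁ refl)) = inj₂ (inj₁ x≡a+d)
      ...   | yes (inj₂ (inj₂ refl)) = inj₂ (inj₂ x≡a+d)
      ...   | no unexpected = contradiction (subst (E G v) (vertex-cong x (a + d) x≡a+d) v~x , unexpected) (none d d<m)

      a-2+2≡a : ∀ a → (a + odd (suc h) + 2) % m ≡ a % m
      a-2+2≡a a = trans (cong (_% m) (around a h)) ([m+n]%n≡m%n a m)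
        where
        around : ∀ a h → a + suc (2 * suc h) + 2 ≡ a + suc (2 * suc (suc h))
        around = solve-∀

      classify : ∀ {v a} → E G v (w a) → ShorterOddClosedWalk k ⊎ ∃ (Clone m w v)
      classify {v} {a} v~a with anyUpTo? (Unexpected? v a) m
      ... | yes (d , d<m , unexp) = inj₁ (unexpected⇒shorter v~a d<m unexp)
      ... | no none = by-sides (E? v (w (a + 2))) (E? v (w (a + odd (suc h))))
        where
        only : ∀ x → E G v (w x) →
               x % m ≡ a % m ⊎ x % m ≡ (a + 2) % m ⊎ x % m ≡ (a + odd (suc h)) % m
        only = only-expected (λ d d<m u → none (d , d<m , u))
        missing : ∀ {x y} → ¬ E G v (w y) → E G v (w x) → ¬ x % m ≡ y % m
        missing v≁y v~x x≡y = v≁y (subst (E G v) (vertex-cong _ _ x≡y) v~x)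
        by-sides : Dec (E G v (w (a + 2))) → Dec (E G v (w (a + odd (suc h)))) →
                   ShorterOddClosedWalk k ⊎ ∃ (Clone m w v)
        by-sides (yes v~a+2) (yes v~a-2) =
          inj₁ (odd-detour⇒shorter v~a+2 (subst (E G v ∘ w) (two-back a h) v~a-2) ≤-refl)
          where
          two-back : ∀ a h → a + suc (2 * suc h) ≡ a + 2 + suc (2 * h)
          two-back = solve-∀
        by-sides (no v≁a+2) (no v≁a-2) = ⊥-elim (pendant⇒⊥ {k} (s≤s z≤n) C v~a λ x v~x →
          [ (λ x≡a → x≡a) , [ ⊥-elim ∘ missing v≁a+2 v~x , ⊥-elim ∘ missing v≁a-2 v~x ] ] (only x v~x))
        by-sides (yes v~a+2) (no v≁a-2) = inj₂ (suc a , clone-of-two v~a v~a+2 λ x v~x →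
          [ inj₁ , [ inj₂ , ⊥-elim ∘ missing v≁a-2 v~x ] ] (only x v~x))
        by-sides (no v≁a+2) (yes v~a-2) =
          inj₂ (suc (a + odd (suc h)) , clone-of-two v~a-2 (subst (E G v) (vertex-cong a _ (sym (a-2+2≡a a))) v~a)
            λ x v~x → [ inj₂ ∘ (λ x≡a → trans x≡a (sym (a-2+2≡a a))) , [ ⊥-elim ∘ missing v≁a+2 v~x , inj₁ ] ]
                        (only x v~x))

    module Propagation {h w} (C : IsInducedCycle (odd (2 + h)) w) where
      open InducedCycle C
      open Classification C

      private
        k m : ℕ
        k = 2 + h
        m = odd k

      5≤m : 5 ≤ m
      5≤m = s≤s (s≤s (s≤s (≤-trans (s≤s (s≤s z≤n)) (m≤n+m (suc (suc (h + 0))) h))))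

      open Replacement 5≤m C

      clone-step : ∀ {y z i} → Clone m w y i → E G y z → ShorterOddClosedWalk k ⊎ ∃ (Clone m w z)
      clone-step {y} {z} {i} y-clone y~z with anyUpTo? (λ x → E? z (w x)) m
      ... | yes (a , _ , z~a) = classify z~a
      ... | no no-neighbour = ⊥-elim (pendant⇒⊥ {k} {a = i} (s≤s z≤n) (replace-isInducedCycle y-clone) z~y pendant)
        where
        z~y : E G z (replace i y i)
        z~y = subst (E G z) (sym (replace-here i y)) (E-sym y~z)
        pendant : ∀ x → E G z (replace i y x) → x % m ≡ i % m
        pendant x z~x with replace-view i y x
        ... | inj₁ (x≡i , _)    = x≡i
        ... | inj₂ (_ , Wx≡wx) = contradiction (x % m , m%n<n x m , z~x%m) no-neighbour
          where
          z~x%m : E G z (w (x % m))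
          z~x%m = subst (E G z) (trans Wx≡wx (vertex-cong x (x % m) (sym (m%n%n≡m%n x m)))) z~x

      clone-walk : ∀ {x y} → Walk G x y → ∃ (Clone m w x) → ShorterOddClosedWalk k ⊎ ∃ (Clone m w y)
      clone-walk here         x-clone       = inj₂ x-clone
      clone-walk (step e W)   (_ , x-clone) = [ inj₁ , clone-walk W ] (clone-step x-clone e)

      clone-all : Connected G → ShorterOddClosedWalk k ⊎ (∀ v → ∃ (Clone m w v))
      clone-all cn = sequence-⊎ λ v → clone-walk (cn (w 0) v) (0 , clone-self 0)

      private
        2<m : 2 < m
        2<m = ≤-trans (s≤s (s≤s (s≤s z≤n))) 5≤m

      clones-consecutive⇒edge : ∀ {u v i j} → Clone m w u i → Clone m w v j → suc i % m ≡ j % m → E G u v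
      clones-consecutive⇒edge {u} {v} {i} {j} u-clone v-clone i+1≡j with E? u v
      ... | yes u~v = u~v
      ... | no  u≁v = ⊥-elim (pendant⇒⊥ {k} {a = 2 + i} (s≤s z≤n) (replace-isInducedCycle u-clone) v~i+2 pendant)
        where
        i+2≢i : (2 + i) % m ≢ i % m
        i+2≢i eq = contradiction (+-%-injectiveʳ i 2<m (>-nonZero⁻¹ m)
          (trans (cong (_% m) (+-comm i 2)) (trans eq (cong (_% m) (sym (+-identityʳ i)))))) λ ()
        v~i+2 : E G v (replace i u (2 + i))
        v~i+2 = subst (E G v) (sym (replace-elsewhere i u (2 + i) i+2≢i))
                  (Clone.adjacent⇒neighbour v-clone (2 + i) (forward (%-cong-suc {m} {j} {suc i} (sym i+1≡j))))
        pendant : ∀ x → E G v (replace i u x) → x % m ≡ (2 + i) % m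
        pendant x v~x with replace-view i u x
        ... | inj₁ (_ , Wx≡u) = contradiction (E-sym (subst (E G v) Wx≡u v~x)) u≁v
        ... | inj₂ (x≢i , Wx≡w) with Clone.neighbour⇒adjacent v-clone x (subst (E G v) Wx≡w v~x)
        ...   | forward j+1≡x  = trans (sym j+1≡x) (%-cong-suc {m} {j} {suc i} (sym i+1≡j))
        ...   | backward x+1≡j = contradiction (%-cancel-suc {m} {x} {i} (trans x+1≡j (sym i+1≡j))) x≢i

      edge⇒clones-adjacent : ∀ {u v i j} → Clone m w u i → Clone m w v j → E G u v →
                             ShorterOddClosedWalk k ⊎ CycAdjMod m i j
      edge⇒clones-adjacent {u} {v} {i} {j} u-clone v-clone u~v with CycAdjMod? i j
      ... | yes adj = inj₂ adj
      ... | no ¬adj = [ inj₁ , ⊥-elim ∘ three-neighbours ]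
                        (Classification.classify (replace-isInducedCycle u-clone) {v} {i} v~A)
        where
        B B′ : ℕ
        B = suc j
        B′ = j + pred m
        B≢A : B % m ≢ i % m
        B≢A eq = ¬adj (backward eq)
        B′≢A : B′ % m ≢ i % m
        B′≢A eq = ¬adj (forward (trans (%-cong-suc {m} {i} {B′} (sym eq)) (suc-+pred-% j)))
        v~A : E G v (replace i u i)
        v~A = subst (E G v) (sym (replace-here i u)) (E-sym u~v)
        v~B : E G v (replace i u B)
        v~B = subst (E G v) (sym (replace-elsewhere i u B B≢A)) (Clone.adjacent⇒neighbour v-clone B (forward refl))
        v~B′ : E G v (replace i u B′)
        v~B′ = subst (E G v) (sym (replace-elsewhere i u B′ B′≢A))
                 (Clone.adjacent⇒neighbour v-clone B′ (backward (suc-+pred-% j)))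
        three-neighbours : ∃ (Clone m (replace i u) v) → ⊥
        three-neighbours (s , v-clone′) with CycAdjMod-three (Clone.neighbour⇒adjacent v-clone′ i v~A)
                                                             (Clone.neighbour⇒adjacent v-clone′ B v~B)
                                                             (Clone.neighbour⇒adjacent v-clone′ B′ v~B′)
        ... | inj₁ A≡B          = B≢A (sym A≡B)
        ... | inj₂ (inj₁ A≡B′)   = B′≢A (sym A≡B′)
        ... | inj₂ (inj₂ B≡B′)   = contradiction
          (+-%-injectiveʳ j (<-trans (s≤s (s≤s z≤n)) 2<m) (≤-reflexive (suc-pred m)) (trans (cong (_% m) (+-comm j 1)) B≡B′))
          (<⇒≢ (pred-mono-≤ (≤-trans (s≤s (s≤s (s≤s z≤n))) 5≤m)))

      module _ (position : ∀ v → ∃ (Clone m w v)) where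

        pos : Fin n → ℕ
        pos v = proj₁ (position v)

        edge⇔pos-adjacent : ∀ u v → ShorterOddClosedWalk k ⊎ (E G u v ⇔ CycAdjMod m (pos u) (pos v))
        edge⇔pos-adjacent u v with E? u v | CycAdjMod? (pos u) (pos v)
        ... | yes u~v | yes adj = inj₂ (mk⇔ (λ _ → adj) (λ _ → u~v))
        ... | no  u≁v | no ¬adj = inj₂ (mk⇔ (λ u~v → contradiction u~v u≁v) (λ adj → contradiction adj ¬adj))
        ... | yes u~v | no ¬adj = [ inj₁ , (λ adj → contradiction adj ¬adj) ]
                                    (edge⇒clones-adjacent (proj₂ (position u)) (proj₂ (position v)) u~v)
        ... | no  u≁v | yes (forward eq) =
          contradiction (clones-consecutive⇒edge (proj₂ (position u)) (proj₂ (position v)) eq) u≁v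
        ... | no  u≁v | yes (backward eq) =
          contradiction (E-sym (clones-consecutive⇒edge (proj₂ (position v)) (proj₂ (position u)) eq)) u≁v

        blowup : (∀ u v → E G u v ⇔ CycAdjMod m (pos u) (pos v)) → BlowupOfCycle G
        blowup iff = m , ≤-trans (s≤s (s≤s (s≤s z≤n))) 5≤m , part , λ u v →
          mk⇔ (cycAdj u v ∘ Equivalence.to (CycAdjMod⇔CycAdj-% (pos u) (pos v)) ∘ Equivalence.to (iff u v))
              (Equivalence.from (iff u v) ∘ Equivalence.from (CycAdjMod⇔CycAdj-% (pos u) (pos v)) ∘ cycAdj⁻¹ u v)
          where
          part : Fin n → Fin m
          part v = fromℕ< (m%n<n (pos v) m)
          cycAdj : ∀ u v → CycAdj m (pos u % m) (pos v % m) → CycAdj m (toℕ (part u)) (toℕ (part v))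
          cycAdj u v = subst₂ (CycAdj m) (sym (toℕ-fromℕ< _)) (sym (toℕ-fromℕ< _))
          cycAdj⁻¹ : ∀ u v → CycAdj m (toℕ (part u)) (toℕ (part v)) → CycAdj m (pos u % m) (pos v % m)
          cycAdj⁻¹ u v = subst₂ (CycAdj m) (toℕ-fromℕ< _) (toℕ-fromℕ< _)

      shorter⊎blowup : Connected G → ShorterOddClosedWalk k ⊎ BlowupOfCycle G
      shorter⊎blowup cn with clone-all cn
      ... | inj₁ shorter  = inj₁ shorter
      ... | inj₂ position =
        map₂ (blowup position) (sequence-⊎ λ u → sequence-⊎ λ v → edge⇔pos-adjacent position u v)

    Triangle : Fin n → Fin n → Fin n → Set
    Triangle a b c = E G a b × E G b c × E G a c

    Triangle-rotate : ∀ {a b c} → Triangle a b c → Triangle b c a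
    Triangle-rotate (a~b , b~c , a~c) = b~c , E-sym a~c , E-sym a~b

    triangleWalk : Fin n → Fin n → Fin n → ℕ → Fin n
    triangleWalk a b c 1 = b
    triangleWalk a b c 2 = c
    triangleWalk a b c _ = a

    triangle-closed : ∀ {a b c} → Triangle a b c → ClosedWalk 3 (triangleWalk a b c)
    triangle-closed (a~b , b~c , a~c) = edges , refl
      where
      edges : Path 3 _
      edges 0 _ = a~b
      edges 1 _ = b~c
      edges 2 _ = E-sym a~c
      edges (suc (suc (suc _))) (s≤s (s≤s (s≤s ())))

    paw-free : ∀ {a b c v} → Triangle a b c → E G v a → ¬ E G v b → ¬ E G v c → ⊥
    paw-free {a} {b} {c} {v} T v~a v≁b v≁c with closedWalk⇒shorter⊎inducedCycle {1} (triangle-closed T)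
    ... | inj₁ (zero , _ , _ , loop) = no-loop loop
    ... | inj₁ (suc _ , s≤s () , _)
    ... | inj₂ C = pendant⇒⊥ {1} {a = 0} (s≤s z≤n) C v~a λ x v~x → only-a (x % 3) (m%n<n x 3) v~x
      where
      only-a : ∀ r → r < 3 → E G v (triangleWalk a b c r) → r ≡ 0
      only-a 0 _ _   = refl
      only-a 1 _ v~b = contradiction v~b v≁b
      only-a 2 _ v~c = contradiction v~c v≁c
      only-a (suc (suc (suc _))) (s≤s (s≤s (s≤s ()))) _

    triangle-neighbour : ∀ {a b c v} → Triangle a b c → E G v a → E G v b ⊎ E G v c
    triangle-neighbour {b = b} {c} {v} T v~a with E? v b | E? v c
    ... | yes v~b | _       = inj₁ v~b
    ... | no  _   | yes v~c = inj₂ v~c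
    ... | no  v≁b | no  v≁c = ⊥-elim (paw-free T v~a v≁b v≁c)

    Touches : Fin n → Fin n → Fin n → Fin n → Set
    Touches a b c v = E G v a ⊎ E G v b ⊎ E G v c

    touches⇒two : ∀ {a b c v} → Triangle a b c → Touches a b c v →
                  (E G v a × E G v b) ⊎ (E G v a × E G v c) ⊎ (E G v b × E G v c)
    touches⇒two T (inj₁ v~a) with triangle-neighbour T v~a
    ... | inj₁ v~b = inj₁ (v~a , v~b)
    ... | inj₂ v~c = inj₂ (inj₁ (v~a , v~c))
    touches⇒two T (inj₂ (inj₁ v~b)) with triangle-neighbour (Triangle-rotate T) v~b
    ... | inj₁ v~c = inj₂ (inj₂ (v~b , v~c))
    ... | inj₂ v~a = inj₁ (v~a , v~b)
    touches⇒two T (inj₂ (inj₂ v~c)) with triangle-neighbour (Triangle-rotate (Triangle-rotate T)) v~c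
    ... | inj₁ v~a = inj₂ (inj₁ (v~a , v~c))
    ... | inj₂ v~b = inj₂ (inj₂ (v~b , v~c))

    module _ (cn : Connected G) where

      touches-every : ∀ {a b c} → Triangle a b c → ∀ v → Touches a b c v
      touches-every {a} {b} {c} T v = along (cn a v) (inj₂ (inj₁ (proj₁ T)))
        where
        step-touches : ∀ {y z} → Touches a b c y → E G y z → Touches a b c z
        step-touches {y} {z} y-touches y~z with E? z a | E? z b | E? z c
        ... | yes z~a | _       | _       = inj₁ z~a
        ... | no  _   | yes z~b | _       = inj₂ (inj₁ z~b)
        ... | no  _   | no  _   | yes z~c = inj₂ (inj₂ z~c)
        ... | no  z≁a | no  z≁b | no  z≁c with touches⇒two T y-touches
        ...   | inj₁ (y~a , y~b)        = ⊥-elim (paw-free (y~a , proj₁ T , y~b) (E-sym y~z) z≁a z≁b)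
        ...   | inj₂ (inj₁ (y~a , y~c)) = ⊥-elim (paw-free (y~a , proj₂ (proj₂ T) , y~c) (E-sym y~z) z≁a z≁c)
        ...   | inj₂ (inj₂ (y~b , y~c)) = ⊥-elim (paw-free (y~b , proj₁ (proj₂ T) , y~c) (E-sym y~z) z≁b z≁c)
        along : ∀ {x y} → Walk G x y → Touches a b c x → Touches a b c y
        along here         x-touches = x-touches
        along (step e W) x-touches = along W (step-touches x-touches e)

      in-triangle : ∀ {a b c} → Triangle a b c → ∀ v → ∃ λ p → ∃ λ q → Triangle v p q
      in-triangle {a} {b} {c} T v with touches⇒two T (touches-every T v)
      ... | inj₁ (v~a , v~b)        = a , b , v~a , proj₁ T , v~b
      ... | inj₂ (inj₁ (v~a , v~c)) = a , c , v~a , proj₂ (proj₂ T) , v~c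
      ... | inj₂ (inj₂ (v~b , v~c)) = b , c , v~b , proj₁ (proj₂ T) , v~c

      edge-dominates : ∀ {a b c} → Triangle a b c → ∀ {x y} → E G x y → ∀ z → E G z x ⊎ E G z y
      edge-dominates T {x} {y} x~y z with E? z x | E? z y
      ... | yes z~x | _       = inj₁ z~x
      ... | no  _   | yes z~y = inj₂ z~y
      ... | no  z≁x | no  z≁y with in-triangle T z
      ...   | p , q , T′@(z~p , p~q , z~q) = ⊥-elim (y-sees-p-or-q (touches⇒two Tx (inj₁ (E-sym x~y))))
        where
        x~p,q : E G x p × E G x q
        x~p,q with touches⇒two T′ (touches-every T′ x)
        ... | inj₁ (x~z , _)        = contradiction (E-sym x~z) z≁x
        ... | inj₂ (inj₁ (x~z , _)) = contradiction (E-sym x~z) z≁x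
        ... | inj₂ (inj₂ x~p,q)     = x~p,q
        Tx : Triangle x p q
        Tx = proj₁ x~p,q , p~q , proj₂ x~p,q
        z-sees : ∀ {r} → E G z r → E G x r → E G y r → ⊥
        z-sees z~r x~r y~r = paw-free (E-sym x~r , x~y , E-sym y~r) z~r z≁x z≁y
        y-sees-p-or-q : (E G y x × E G y p) ⊎ (E G y x × E G y q) ⊎ (E G y p × E G y q) → ⊥
        y-sees-p-or-q (inj₁ (_ , y~p))        = z-sees z~p (proj₁ x~p,q) y~p
        y-sees-p-or-q (inj₂ (inj₁ (_ , y~q))) = z-sees z~q (proj₂ x~p,q) y~q
        y-sees-p-or-q (inj₂ (inj₂ (y~p , _))) = z-sees z~p (proj₁ x~p,q) y~p

      triangle⇒completeMultipartite : ∀ {a b c} → Triangle a b c → CompleteMultipartite G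
      triangle⇒completeMultipartite T = n , part , λ u v → mk⇔ (edge⇒parts-differ u v) (parts-differ⇒edge u v)
        where
        non-neighbours : Fin n → Fin n → Bool
        non-neighbours v u = adj G u v
        part : Fin n → Fin n
        part v = firstFalse (non-neighbours v) v
        false⇒≁ : ∀ {x y} → adj G x y ≡ false → ¬ E G x y
        false⇒≁ x≁y x~y = contradiction (trans (sym x≁y) x~y) λ ()
        edge⇒parts-differ : ∀ u v → E G u v → part u ≢ part v
        edge⇒parts-differ u v u~v same = [ false⇒≁ r≁u , false⇒≁ r≁v ] (edge-dominates T u~v (part u))
          where
          r≁u : adj G (part u) u ≡ false
          r≁u = firstFalse-false (non-neighbours u) u (irrefl G u)
          r≁v : adj G (part u) v ≡ false
          r≁v = subst (λ r → adj G r v ≡ false) (sym same) (firstFalse-false (non-neighbours v) v (irrefl G v))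
        parts-differ⇒edge : ∀ u v → part u ≢ part v → E G u v
        parts-differ⇒edge u v differ with E? u v
        ... | yes u~v = u~v
        ... | no  u≁v = contradiction (firstFalse-cong _ _ u v (irrefl G u) (irrefl G v) twins) differ
          where
          twins : ∀ z → adj G z u ≡ adj G z v
          twins z with adj G z u in zu | adj G z v in zv
          ... | true  | true  = refl
          ... | false | false = refl
          ... | true  | false = ⊥-elim ([ false⇒≁ zv ∘ E-sym , u≁v ∘ E-sym ] (edge-dominates T zu v))
          ... | false | true  = ⊥-elim ([ false⇒≁ zu ∘ E-sym , u≁v ] (edge-dominates T zv u))

      inducedOddCycle⇒shorter⊎multipartite⊎blowup : ∀ {k w} → IsInducedCycle (odd k) w →
                         ShorterOddClosedWalk k ⊎ CompleteMultipartite G ⊎ BlowupOfCycle G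
      inducedOddCycle⇒shorter⊎multipartite⊎blowup {zero} {w} C =
        ⊥-elim (E-irrefl (subst (E G (w 0)) (vertex-cong 1 0 refl) (edge 0)))
        where open IsInducedCycle C
      inducedOddCycle⇒shorter⊎multipartite⊎blowup {suc zero} C =
        inj₂ (inj₁ (triangle⇒completeMultipartite (edge 0 , edge 1 , adjacent⇒edge 0 2 (backward refl))))
        where open InducedCycle C
      inducedOddCycle⇒shorter⊎multipartite⊎blowup {suc (suc j)} C = map₂ inj₂ (Propagation.shorter⊎blowup C cn)

      oddClosedWalk⇒multipartite⊎blowup : ∀ k {u} → ClosedWalk (odd k) u → CompleteMultipartite G ⊎ BlowupOfCycle G
      oddClosedWalk⇒multipartite⊎blowup = oddClosedWalk-elim inducedOddCycle⇒shorter⊎multipartite⊎blowup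

  -- Walks and the parity colouring

  length : ∀ {x y} → Walk G x y → ℕ
  length here       = 0
  length (step _ W) = suc (length W)

  _++_ : ∀ {x y z} → Walk G x y → Walk G y z → Walk G x z
  here     ++ V = V
  step e W ++ V = step e (W ++ V)

  reverse : ∀ {x y} → Walk G x y → Walk G y x
  reverse here       = here
  reverse (step e W) = reverse W ++ step (E-sym e) here

  length-++ : ∀ {x y z} (W : Walk G x y) (V : Walk G y z) → length (W ++ V) ≡ length W + length V
  length-++ here       V = refl
  length-++ (step e W) V = cong suc (length-++ W V)

  length-reverse : ∀ {x y} (W : Walk G x y) → length (reverse W) ≡ length W
  length-reverse here       = refl
  length-reverse (step e W) = trans (length-++ (reverse W) _) (trans (cong (_+ 1) (length-reverse W)) (+-comm (length W) 1))

  vertexAt : ∀ {x y} → Walk G x y → ℕ → Fin n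
  vertexAt (here {u})     _       = u
  vertexAt (step {u} _ _) zero    = u
  vertexAt (step _ W)     (suc t) = vertexAt W t

  vertexAt-start : ∀ {x y} (W : Walk G x y) → vertexAt W 0 ≡ x
  vertexAt-start here       = refl
  vertexAt-start (step _ _) = refl

  vertexAt-end : ∀ {x y} (W : Walk G x y) → vertexAt W (length W) ≡ y
  vertexAt-end here       = refl
  vertexAt-end (step _ W) = vertexAt-end W

  vertexAt-path : ∀ {x y} (W : Walk G x y) → Path (length W) (vertexAt W)
  vertexAt-path (step e W) zero    _       = subst (E G _) (sym (vertexAt-start W)) e
  vertexAt-path (step e W) (suc t) (s≤s t<) = vertexAt-path W t t<

  closedWalk : ∀ {x} (W : Walk G x x) → ClosedWalk (length W) (vertexAt W)
  closedWalk W = vertexAt-path W , trans (vertexAt-end W) (sym (vertexAt-start W))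

  module _ (cn : Connected G) (root : Fin n) where

    parity : Fin n → Bool
    parity v = oddᵇ (length (cn root v))

    monochromatic-edge⇒oddClosedWalk : ∀ {u v} → E G u v → parity u ≡ parity v →
                                       ∃ λ k → Σ (ℕ → Fin n) (ClosedWalk (odd k))
    monochromatic-edge⇒oddClosedWalk {u} {v} u~v same = odd-length (oddᵇ⇒odd (length W) W-odd)
      where
      W : Walk G root root
      W = cn root u ++ step u~v (reverse (cn root v))
      W-odd : oddᵇ (length W) ≡ true
      W-odd = begin
        oddᵇ (length W)                              ≡⟨ cong oddᵇ (length-++ (cn root u) _) ⟩
        oddᵇ (length (cn root u) + suc (length V))   ≡⟨ oddᵇ-+ (length (cn root u)) (suc (length V)) ⟩
        parity u xor not (oddᵇ (length V))           ≡⟨ cong (λ l → parity u xor not (oddᵇ l)) (length-reverse (cn root v)) ⟩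
        parity u xor not (parity v)                  ≡⟨ cong (λ c → c xor not (parity v)) same ⟩
        parity v xor not (parity v)                  ≡⟨ not-distribʳ-xor (parity v) (parity v) ⟨
        not (parity v xor parity v)                  ≡⟨ cong not (xor-same (parity v)) ⟩
        true                                         ∎
        where
        open ≡-Reasoning
        V : Walk G v root
        V = reverse (cn root v)
      odd-length : (∃ λ k → length W ≡ odd k) → ∃ λ k → Σ (ℕ → Fin n) (ClosedWalk (odd k))
      odd-length (k , W≡odd) = k , vertexAt W , subst (λ L → ClosedWalk L (vertexAt W)) W≡odd (closedWalk W)

    bipartite⊎oddClosedWalk : Bipartite G ⊎ ∃ λ k → Σ (ℕ → Fin n) (ClosedWalk (odd k))
    bipartite⊎oddClosedWalk = swap (map₂ (parity ,_) (sequence-⊎ λ u → sequence-⊎ λ v → check u v))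
      where
      check : ∀ u v → (∃ λ k → Σ (ℕ → Fin n) (ClosedWalk (odd k))) ⊎ (E G u v → parity u ≢ parity v)
      check u v with E? u v | parity u Data.Bool.≟ parity v
      ... | yes u~v | yes same = inj₁ (monochromatic-edge⇒oddClosedWalk u~v same)
      ... | no  u≁v | _        = inj₂ λ u~v _ → u≁v u~v
      ... | yes _   | no  diff = inj₂ λ _ → diff

  -- Graphs containing an induced odd pan

  PanAdjℕ : ℕ → ℕ → ℕ → Set
  PanAdjℕ m a b = (a < m × b < m × CycAdj m a b) ⊎ (a ≡ 0 × b ≡ m) ⊎ (a ≡ m × b ≡ 0)

  module InducedOddPan {k} {f : Fin (suc (odd (suc k))) → Fin n}
                       (pan : ∀ i j → PanAdj (odd (suc k)) i j ⇔ E G (f i) (f j)) where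

    -- The pan's cycle is 0, 1, …, s, t (so t is adjacent to 0) and m is the pendant vertex at 0.
    private
      m t s : ℕ
      m = odd (suc k)
      t = 2 * suc k
      s = pred t

    -- The pan vertex numbered a, for a ≤ m; the % only serves to stay in range.
    at : ℕ → Fin n
    at a = f (fromℕ< (m%n<n a (suc m)))

    index-at : ∀ {a} → a ≤ m → toℕ (fromℕ< (m%n<n a (suc m))) ≡ a
    index-at a≤m = trans (toℕ-fromℕ< _) (m<n⇒m%n≡m (s≤s a≤m))

    PanAdjℕ-bounded : ∀ {a b} → PanAdjℕ m a b → a ≤ m × b ≤ m
    PanAdjℕ-bounded (inj₁ (a<m , b<m , _))    = <⇒≤ a<m , <⇒≤ b<m
    PanAdjℕ-bounded (inj₂ (inj₁ (refl , refl))) = z≤n , ≤-refl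
    PanAdjℕ-bounded (inj₂ (inj₂ (refl , refl))) = ≤-refl , z≤n

    pan-edge : ∀ a b → PanAdjℕ m a b → E G (at a) (at b)
    pan-edge a b adj = Equivalence.to (pan _ _) (subst₂ (PanAdjℕ m) (sym (index-at a≤m)) (sym (index-at b≤m)) adj)
      where
      a≤m : a ≤ m
      a≤m = proj₁ (PanAdjℕ-bounded adj)
      b≤m : b ≤ m
      b≤m = proj₂ (PanAdjℕ-bounded adj)

    pan-non-edge : ∀ {a b} → a ≤ m → b ≤ m → ¬ PanAdjℕ m a b → ¬ E G (at a) (at b)
    pan-non-edge a≤m b≤m ¬adj = ¬adj ∘ subst₂ (PanAdjℕ m) (index-at a≤m) (index-at b≤m) ∘ Equivalence.from (pan _ _)

    3≤m : 3 ≤ m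
    3≤m = s≤s (*-monoʳ-≤ 2 (s≤s z≤n))

    1≤s : 1 ≤ s
    1≤s = ≤-trans (s≤s z≤n) (m≤n+m (suc (k + 0)) k)

    1<m : 1 < m
    1<m = ≤-trans (s≤s (s≤s z≤n)) 3≤m

    2<m : 2 < m
    2<m = 3≤m

    s<m : s < m
    s<m = n≤1+n t

    cycle≁pendant : ∀ {a} → 1 ≤ a → a < m → ¬ PanAdjℕ m a m
    cycle≁pendant _   _   (inj₁ (_ , m<m , _))   = <-irrefl refl m<m
    cycle≁pendant 1≤a _   (inj₂ (inj₁ (a≡0 , _))) = contradiction (subst (1 ≤_) a≡0 1≤a) λ ()
    cycle≁pendant _   a<m (inj₂ (inj₂ (a≡m , _))) = <-irrefl a≡m a<m

    2≁t : ¬ PanAdjℕ m 2 t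
    2≁t (inj₁ (_ , _ , inj₁ 3≡t))                  = even≢odd (suc k) 1 (sym 3≡t)
    2≁t (inj₁ (_ , _ , inj₂ (inj₁ 1+t≡2)))         = even≢odd (suc k) 0 (suc-injective 1+t≡2)
    2≁t (inj₁ (_ , _ , inj₂ (inj₂ (inj₁ (() , _)))))
    2≁t (inj₁ (_ , _ , inj₂ (inj₂ (inj₂ (() , _)))))
    2≁t (inj₂ (inj₁ (() , _)))
    2≁t (inj₂ (inj₂ (2≡m , _)))                    = <-irrefl 2≡m 2<m

    bipartite⇒⊥ : Bipartite G → ⊥
    bipartite⇒⊥ (colour , proper) =
      proper (at 0) (at t) (pan-edge 0 t (inj₁ (s≤s z≤n , n<1+n t , inj₂ (inj₂ (inj₁ (refl , refl))))))
        (sym (trans (alternate t (n<1+n t)) (trans (cong (colour (at 0) xor_) (oddᵇ-2* (suc k))) (xor-identityʳ _))))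
      where
      alternate : ∀ a → a < m → colour (at a) ≡ colour (at 0) xor oddᵇ a
      alternate zero    _     = sym (xor-identityʳ _)
      alternate (suc a) 1+a<m = begin
        colour (at (suc a))            ≡⟨ ¬-not (proper _ _ (E-sym (pan-edge a (suc a) (inj₁ (a<m , 1+a<m , inj₁ refl))))) ⟩
        not (colour (at a))            ≡⟨ cong not (alternate a a<m) ⟩
        not (colour (at 0) xor oddᵇ a) ≡⟨ not-distribʳ-xor (colour (at 0)) (oddᵇ a) ⟩
        colour (at 0) xor oddᵇ (suc a) ∎
        where
        open ≡-Reasoning
        a<m : a < m
        a<m = <-trans (n<1+n a) 1+a<m

    completeMultipartite⇒⊥ : CompleteMultipartite G → ⊥
    completeMultipartite⇒⊥ (r , part , iff) =
      Equivalence.to (iff (at 1) (at 2)) (pan-edge 1 2 (inj₁ (1<m , 2<m , inj₁ refl)))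
        (trans (same-part (pan-non-edge (<⇒≤ 1<m) ≤-refl (cycle≁pendant (s≤s z≤n) 1<m)))
               (sym (same-part (pan-non-edge (<⇒≤ 2<m) ≤-refl (cycle≁pendant (s≤s z≤n) 2<m)))))
      where
      same-part : ∀ {x y} → ¬ E G x y → part x ≡ part y
      same-part {x} {y} x≁y with part x Fin.≟ part y
      ... | yes same = same
      ... | no  diff = contradiction (Equivalence.from (iff x y) diff) x≁y

    blowupOfCycle⇒⊥ : BlowupOfCycle G → ⊥
    blowupOfCycle⇒⊥ (r , 3≤r , part , iff) = case two-of-three-neighbours-share-a-part of λ where
        (inj₁ 1≡t)        → separated 1≡t 2~1 (pan-non-edge (<⇒≤ 2<m) (n≤1+n t) 2≁t)
        (inj₂ (inj₁ 1≡m)) → separated 1≡m 2~1 (pan-non-edge (<⇒≤ 2<m) ≤-refl (cycle≁pendant (s≤s z≤n) 2<m))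
        (inj₂ (inj₂ t≡m)) → separated t≡m (pan-edge s t (inj₁ (s<m , n<1+n t , inj₁ refl)))
                                          (pan-non-edge (<⇒≤ s<m) ≤-refl (cycle≁pendant 1≤s s<m))
      where
      adjacent-parts : ∀ {x y} → E G x y → CycAdj r (toℕ (part x)) (toℕ (part y))
      adjacent-parts {x} {y} = Equivalence.to (iff x y)
      two-of-three-neighbours-share-a-part : toℕ (part (at 1)) ≡ toℕ (part (at t)) ⊎
        toℕ (part (at 1)) ≡ toℕ (part (at m)) ⊎ toℕ (part (at t)) ≡ toℕ (part (at m))
      two-of-three-neighbours-share-a-part =
        CycAdj-three {r} {{>-nonZero (≤-trans (s≤s z≤n) 3≤r)}} (toℕ<n _) (toℕ<n _) (toℕ<n _)
          (adjacent-parts (pan-edge 0 1 (inj₁ (s≤s z≤n , 1<m , inj₁ refl))))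
          (adjacent-parts (pan-edge 0 t (inj₁ (s≤s z≤n , n<1+n t , inj₂ (inj₂ (inj₁ (refl , refl)))))))
          (adjacent-parts (pan-edge 0 m (inj₂ (inj₁ (refl , refl)))))
      2~1 : E G (at 2) (at 1)
      2~1 = pan-edge 2 1 (inj₁ (2<m , 1<m , inj₂ (inj₁ refl)))
      separated : ∀ {x y z} → toℕ (part x) ≡ toℕ (part y) → E G z x → ¬ E G z y → ⊥
      separated {x} {y} {z} same z~x z≁y =
        z≁y (Equivalence.from (iff z y) (subst (CycAdj r (toℕ (part z))) same (adjacent-parts z~x)))

oddPanFree⇒bipartite⊎multipartite⊎blowup : ∀ {n} (G : Graph n) → Connected G → OddPanFree G →
                Bipartite G ⊎ CompleteMultipartite G ⊎ BlowupOfCycle G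
oddPanFree⇒bipartite⊎multipartite⊎blowup {zero}  G _  _  = inj₁ ((λ ()) , λ ())
oddPanFree⇒bipartite⊎multipartite⊎blowup {suc n} G cn pf =
  map₂ (λ (k , _ , cw) → oddClosedWalk⇒multipartite⊎blowup G pf cn k cw) (bipartite⊎oddClosedWalk G cn Fin.zero)

bipartite⊎multipartite⊎blowup⇒oddPanFree : ∀ {n} (G : Graph n) →
  Bipartite G ⊎ CompleteMultipartite G ⊎ BlowupOfCycle G → OddPanFree G
bipartite⊎multipartite⊎blowup⇒oddPanFree G classes zero    ()
bipartite⊎multipartite⊎blowup⇒oddPanFree G classes (suc k) _ (f , _ , pan) =
  [ bipartite⇒⊥ , [ completeMultipartite⇒⊥ , blowupOfCycle⇒⊥ ] ] classes
  where open InducedOddPan G {k} {f} pan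

proposition3p19 : ∀ {n : ℕ} (G : Graph n) → Connected G →
    OddPanFree G ⇔ (Bipartite G ⊎ CompleteMultipartite G ⊎ BlowupOfCycle G)
proposition3p19 G cn =
  mk⇔ (oddPanFree⇒bipartite⊎multipartite⊎blowup G cn) (bipartite⊎multipartite⊎blowup⇒oddPanFree G)
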